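{- Let $a$ be an integer and $d$ a positive integer with $\gcd(a,d)=1$, and let $S$ be any finite set of primes. Then there exists an $S$-good isomorphism from $\mathbb{Z}$ to $a+d\mathbb{Z}$.
   Context: For an integer $a$ and positive integer $d$, $a+d\mathbb{Z}=\{a+dn : n\in\mathbb{Z}\}$. An isomorphism between two such arithmetic progressions $X$ and $Y$ (with $\mathbb{Z}=0+1\mathbb{Z}$ included) is an order-preserving bijection $\varphi:X\to Y$, i.e. a bijection with $\varphi(x)<\varphi(x')$ iff $x<x'$. For a finite set $S$ of primes, an isomorphism $\varphi:\mathbb{Z}\to a+d\mathbb{Z}$ is called $S$-good if for every $n\in\mathbb{Z}$: whenever $n$ is coprime to all primes in $S$, then $\varphi(n)$ is coprime to all primes in $S$. -}

module Defs where

open import Data.Nat as ℕ using (ℕ; suc)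
open import Data.Nat.Primality using (Prime)
open import Data.Integer using (ℤ; _+_; _*_; _<_; +_)
open import Data.Integer.Divisibility using (_∣_)
open import Data.List using (List)
open import Data.List.Membership.Propositional using (_∈_)
open import Data.Product using (Σ; ∃; _×_)
open import Relation.Binary.PropositionalEquality using (_≡_)
open import Relation.Nullary using (¬_)
open import Function.Bundles using (_⇔_)

_∈AP[_,_] : ℤ → ℤ → ℤ → Set
y ∈AP[ a , d ] = ∃ λ (k : ℤ) → y ≡ a + d * k

AllPrime : List ℕ → Set
AllPrime S = ∀ {p} → p ∈ S → Prime p

CoprimeToAll : List ℕ → ℤ → Set
CoprimeToAll S n = ∀ {p} → p ∈ S → ¬ ((+ p) ∣ n)

IsAPIso : ℤ → ℤ → (ℤ → ℤ) → Set
IsAPIso a d φ =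
  (∀ n → φ n ∈AP[ a , d ])
  × (∀ y → y ∈AP[ a , d ] → ∃ λ n → φ n ≡ y)
  × (∀ n m → (φ n < φ m) ⇔ (n < m))

IsSGood : List ℕ → (ℤ → ℤ) → Set
IsSGood S φ = ∀ n → CoprimeToAll S n → CoprimeToAll S (φ n)

-- Choose u ≡ 1 (mod d) divisible by every p ∈ S coprime to d (a product of Bézout
-- multiples), and take φ n = a u + d n. Since a u ≡ a (mod d), φ is the translation
-- of n ↦ d n onto a + dℤ. If p ∣ φ n for some p ∈ S, then either p ∣ d, and then
-- p ∣ a u ≡ a (mod d) contradicts gcd(a, d) = 1, or p ∤ d, and then p ∣ a u forces
-- p ∣ d n, hence p ∣ n.
module Submission where

open import Defs
open import Data.Nat using (ℕ; _<_)
open import Data.Nat.Coprimality using (Coprime)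
open import Data.Integer using (ℤ; +_; ∣_∣)
open import Data.List using (List)
open import Data.Product using (∃; _×_)

open import Data.Nat as ℕ using (suc)
import Data.Nat.Divisibility as ℕ
open import Data.Nat.Coprimality using (coprime?; coprime-Bézout)
open import Data.Nat.GCD using (module Bézout)
open import Data.Nat.Primality using (Prime; ¬prime[1]; prime⇒irreducible)
open import Data.Integer using (_+_; _*_; -_; _-_; 0ℤ; 1ℤ; Positive)
import Data.Integer as ℤ
open import Data.Integer.Properties
  using (pos-+; pos-*; *-comm; *-zeroʳ; +-monoʳ-<; *-monoˡ-<-pos; <-cmp; <-irrefl; <-asym)
open import Data.Integer.Divisibility.Signed
  using (∣-refl; ∣ᵤ⇒∣; ∣⇒∣ᵤ; ∣m⇒∣-m; ∣n⇒∣m*n; ∣m⇒∣m*n; ∣m+n∣m⇒∣n; ∣m+n∣n⇒∣m)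
  renaming (_∣_ to _∣ₛ_)
import Data.Integer.Coprimality as ℤ
open import Data.Integer.Divisibility using (_∣_)
open import Data.Integer.Tactic.RingSolver using (solve-∀)
open import Data.List using ([]; _∷_)
open import Data.List.Membership.Propositional using (_∈_)
open import Data.List.Relation.Unary.Any using (here; there)
open import Data.Product using (_,_; proj₁)
open import Data.Sum using (inj₁; inj₂)
open import Data.Empty using (⊥-elim)
open import Relation.Nullary using (¬_; yes; no)
open import Relation.Binary.Definitions using (tri<; tri≈; tri>)
open import Relation.Binary.PropositionalEquality
open import Function.Bundles using (_⇔_; mk⇔)

prime∤⇒coprime : ∀ {p n} → Prime p → ¬ (p ℕ.∣ n) → Coprime p n
prime∤⇒coprime pr p∤n {i} (i∣p , i∣n) with prime⇒irreducible pr i∣p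
... | inj₁ i≡1  = i≡1
... | inj₂ refl = ⊥-elim (p∤n i∣n)

pos-1+* : ∀ m n {k} → 1 ℕ.+ m ℕ.* n ≡ k → 1ℤ + + m * + n ≡ + k
pos-1+* m n refl = begin
  1ℤ + + m * + n    ≡⟨ cong (λ w → 1ℤ + w) (sym (pos-* m n)) ⟩
  1ℤ + + (m ℕ.* n)  ≡⟨ sym (pos-+ 1 (m ℕ.* n)) ⟩
  + (1 ℕ.+ m ℕ.* n) ∎
  where open ≡-Reasoning

∈AP[1]-* : ∀ e {u v} → u ∈AP[ 1ℤ , e ] → v ∈AP[ 1ℤ , e ] → (u * v) ∈AP[ 1ℤ , e ]
∈AP[1]-* e (s , refl) (t , refl) = s + t + e * s * t , expand e s t
  where
  expand : ∀ E S T → (1ℤ + E * S) * (1ℤ + E * T) ≡ 1ℤ + E * (S + T + E * S * T)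
  expand = solve-∀

*-∈AP[1] : ∀ a e {u} → u ∈AP[ 1ℤ , e ] → (a * u) ∈AP[ a , e ]
*-∈AP[1] a e (t , refl) = a * t , distrib a e t
  where
  distrib : ∀ A E T → A * (1ℤ + E * T) ≡ A + E * (A * T)
  distrib = solve-∀

coprime⇒∃multiple∈AP[1] : ∀ {p d} → Coprime p d → ∃ λ v → v ∈AP[ 1ℤ , + d ] × + p ∣ₛ v
coprime⇒∃multiple∈AP[1] {p} {d} p⊥d with coprime-Bézout p⊥d
... | Bézout.+- x y eq = + x * + p , (+ y , member) , ∣n⇒∣m*n (+ x) ∣-refl
  where
  open ≡-Reasoning
  member : + x * + p ≡ 1ℤ + + d * + y
  member = begin
    + x * + p       ≡⟨ sym (pos-* x p) ⟩
    + (x ℕ.* p)     ≡⟨ sym (pos-1+* y d eq) ⟩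
    1ℤ + + y * + d  ≡⟨ cong (λ w → 1ℤ + w) (*-comm (+ y) (+ d)) ⟩
    1ℤ + + d * + y  ∎
... | Bézout.-+ x y eq =
  - (+ x * + p) , (- + y , member) , ∣m⇒∣-m (∣n⇒∣m*n (+ x) ∣-refl)
  where
  open ≡-Reasoning
  member : - (+ x * + p) ≡ 1ℤ + + d * - + y
  member = begin
    - (+ x * + p)               ≡⟨ as-difference (+ x) (+ p) ⟩
    1ℤ - (1ℤ + + x * + p)       ≡⟨ cong (λ w → 1ℤ - w) (trans (pos-1+* x p eq) (pos-* y d)) ⟩
    1ℤ - + y * + d              ≡⟨ as-sum (+ y) (+ d) ⟩
    1ℤ + + d * - + y            ∎
    where
    as-difference : ∀ X P → - (X * P) ≡ 1ℤ - (1ℤ + X * P)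
    as-difference = solve-∀
    as-sum : ∀ Y D → 1ℤ - Y * D ≡ 1ℤ + D * - Y
    as-sum = solve-∀

∃common-multiple∈AP[1] : (d : ℕ) (S : List ℕ) →
  ∃ λ u → u ∈AP[ 1ℤ , + d ] × (∀ {p} → p ∈ S → Coprime p d → + p ∣ₛ u)
∃common-multiple∈AP[1] d [] = 1ℤ , (0ℤ , sym (cong (λ w → 1ℤ + w) (*-zeroʳ (+ d)))) , λ ()
∃common-multiple∈AP[1] d (q ∷ S) with ∃common-multiple∈AP[1] d S | coprime? q d
... | u , u∈AP , S∣u | no q⊥̸d = u , u∈AP , λ
  { (here refl) q⊥d → ⊥-elim (q⊥̸d q⊥d)
  ; (there p∈S) p⊥d → S∣u p∈S p⊥d }
... | u , u∈AP , S∣u | yes q⊥d with coprime⇒∃multiple∈AP[1] q⊥d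
...   | v , v∈AP , q∣v = u * v , ∈AP[1]-* (+ d) u∈AP v∈AP , λ
  { (here refl) _   → ∣n⇒∣m*n u q∣v
  ; (there p∈S) p⊥d → ∣m⇒∣m*n v (S∣u p∈S p⊥d) }

strictMono⇒<⇔ : ∀ {f : ℤ → ℤ} → (∀ {n m} → n ℤ.< m → f n ℤ.< f m) →
  ∀ n m → (f n ℤ.< f m) ⇔ (n ℤ.< m)
strictMono⇒<⇔ {f} mono n m = mk⇔ reflect mono
  where
  reflect : f n ℤ.< f m → n ℤ.< m
  reflect fn<fm with <-cmp n m
  ... | tri< n<m _ _ = n<m
  ... | tri≈ _ refl _ = ⊥-elim (<-irrefl refl fn<fm)
  ... | tri> _ _ m<n = ⊥-elim (<-asym fn<fm (mono m<n))

translation-isAPIso : ∀ a e {c} .{{_ : Positive e}} → c ∈AP[ a , e ] →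
  IsAPIso a e (λ n → c + e * n)
translation-isAPIso a e {c} (k , refl) =
  (λ n → k + n , shift a e k n) ,
  (λ { y (j , refl) → j - k , unshift a e k j }) ,
  strictMono⇒<⇔ (λ n<m → +-monoʳ-< c (*-monoˡ-<-pos e n<m))
  where
  shift : ∀ A E K N → A + E * K + E * N ≡ A + E * (K + N)
  shift = solve-∀
  unshift : ∀ A E K J → A + E * K + E * (J - K) ≡ A + E * J
  unshift = solve-∀

∈AP-coprime⇒∤ : ∀ {a d p y} → Coprime ∣ a ∣ d → Prime p → p ℕ.∣ d →
  y ∈AP[ a , + d ] → ¬ (+ p ∣ₛ y)
∈AP-coprime⇒∤ {a} {d} {p} a⊥d pr p∣d (k , refl) p∣y =
  ¬prime[1] (subst Prime (a⊥d (∣⇒∣ᵤ p∣a , p∣d)) pr)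
  where
  p∣a : + p ∣ₛ a
  p∣a = ∣m+n∣n⇒∣m p∣y (∣m⇒∣m*n k (∣ᵤ⇒∣ {+ p} {+ d} p∣d))

∣c+dn⇒∣n : ∀ {p d c n} → Coprime p d → + p ∣ₛ c → + p ∣ₛ c + + d * n → + p ∣ n
∣c+dn⇒∣n {p} {d} {n = n} p⊥d p∣c p∣c+dn =
  ℤ.coprime-divisor (+ p) (+ d) n p⊥d (∣⇒∣ᵤ (∣m+n∣m⇒∣n p∣c+dn p∣c))

lemma2p7 : (a : ℤ) (d : ℕ) → 0 < d → Coprime ∣ a ∣ d →
    (S : List ℕ) → AllPrime S →
    ∃ λ (φ : ℤ → ℤ) → IsAPIso a (+ d) φ × IsSGood S φ
lemma2p7 a d@(suc _) _ a⊥d S allPrime with ∃common-multiple∈AP[1] d S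
... | u , u∈AP , S∣u = φ , φ-iso , φ-good
  where
  φ : ℤ → ℤ
  φ n = a * u + + d * n
  φ-iso : IsAPIso a (+ d) φ
  φ-iso = translation-isAPIso a (+ d) (*-∈AP[1] a (+ d) u∈AP)
  φ-good : IsSGood S φ
  φ-good n n⊥S {p} p∈S p∣φn with p ℕ.∣? d
  ... | yes p∣d = ∈AP-coprime⇒∤ {a} a⊥d (allPrime p∈S) p∣d (proj₁ φ-iso n) (∣ᵤ⇒∣ p∣φn)
  ... | no p∤d = n⊥S p∈S (∣c+dn⇒∣n p⊥d (∣n⇒∣m*n a (S∣u p∈S p⊥d)) (∣ᵤ⇒∣ p∣φn))
    where p⊥d = prime∤⇒coprime (allPrime p∈S) p∤d
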